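{- Let $G$ be a minimal counterexample (as defined in the context). Let $v$ be a vertex of degree $2$ of $G$, with neighbours $u$ and $w$. If $\deg(u)\le 6$, then $u$ and $w$ are adjacent in $G$.
   Context: All graphs are simple. An edge-face $9$-colouring of a plane graph is a map from its edges and faces to $\{1,\dots,9\}$ such that adjacent edges get different colours, an edge and any face incident to it get different colours, and two distinct adjacent faces get different colours. A minimal counterexample is a simple plane graph $G$ (with a fixed embedding) of maximum degree $8$ which has no edge-face $9$-colouring, such that every simple plane graph of maximum degree at most $8$ with fewer edges than $G$ has an edge-face $9$-colouring. -}

module Defs where

open import Data.Nat using (ℕ; zero; suc; _+_; _≤_; _<_)
open import Data.Fin using (Fin; zero; suc; _≟_)
open import Data.Bool using (Bool; true; false; not; _∧_; _∨_; if_then_else_)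
open import Data.Product using (Σ; ∃; _×_; _,_; proj₁; proj₂)
open import Data.Sum using (_⊎_; inj₁; inj₂)
open import Function using (_∘_)
open import Relation.Nullary using (¬_)
open import Relation.Nullary.Decidable using (⌊_⌋)
open import Relation.Binary.PropositionalEquality using (_≡_; _≢_)
open import Relation.Binary.Construct.Closure.ReflexiveTransitive using (Star)

countFin : ∀ {k} → (Fin k → Bool) → ℕ
countFin {zero}  p = 0
countFin {suc k} p = (if p zero then 1 else 0) + countFin (p ∘ suc)

anyFin : ∀ {k} → (Fin k → Bool) → Bool
anyFin {zero}  p = false
anyFin {suc k} p = p zero ∨ anyFin (p ∘ suc)

_==_ : ∀ {k} → Fin k → Fin k → Bool
i == j = ⌊ i ≟ j ⌋

iterate : ∀ {A : Set} → (A → A) → ℕ → A → A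
iterate f zero    x = x
iterate f (suc k) x = f (iterate f k x)

-- Darts of a graph with m edges: dart (e , b) is edge e traversed in
-- direction b.  The edge-reversal involution α flips b.

Dart : ℕ → Set
Dart m = Fin m × Bool

α : ∀ {m} → Dart m → Dart m
α (e , b) = (e , not b)

anyDart : ∀ {m} → (Dart m → Bool) → Bool
anyDart p = anyFin (λ e → p (e , true)) ∨ anyFin (λ e → p (e , false))

-- A simple plane graph with a fixed embedding, described combinatorially
-- (up to homeomorphism of the sphere / plane):
--  * vertices Fin n, edges Fin m, darts Fin m × Bool, tail map;
--  * a rotation system σ (cyclic order of darts around each vertex);
--  * facial walks = orbits of φ = σ ∘ α, labelled by Fin w;
--  * (nontrivial) connected components labelled by Fin c, each of genus 0
--    (Euler: V_i − E_i + W_i = 2);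
--  * faces Fin f of the whole plane graph: each face is a set of facial
--    walks (one boundary walk per component bordering it), and the
--    bipartite component/face incidence multigraph (one edge per facial
--    walk) is a tree: connected, with w + 1 = c + f.
-- Isolated vertices carry no darts and lie inside some face; they do not
-- affect faces or their boundaries.

record PlaneGraph : Set where
  field
    n : ℕ
    m : ℕ
    tail : Dart m → Fin n
  head : Dart m → Fin n
  head d = tail (α d)
  field
    noLoop     : ∀ d → tail d ≢ head d
    noParallel : ∀ d d' → tail d ≡ tail d' → head d ≡ head d' → d ≡ d'
    σ      : Dart m → Dart m
    σ⁻¹    : Dart m → Dart m
    σσ⁻¹   : ∀ d → σ (σ⁻¹ d) ≡ d
    σ⁻¹σ   : ∀ d → σ⁻¹ (σ d) ≡ d
    σ-tail : ∀ d → tail (σ d) ≡ tail d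
    σ-cyc  : ∀ d d' → tail d ≡ tail d' → ∃ λ k → iterate σ k d ≡ d'
  φ : Dart m → Dart m
  φ d = σ (α d)
  field
    w        : ℕ
    walkOf   : Dart m → Fin w
    walk-sur : ∀ j → ∃ λ d → walkOf d ≡ j
    walk-orb : ∀ d d' → walkOf d ≡ walkOf d' → ∃ λ k → iterate φ k d ≡ d'
    orb-walk : ∀ d k → walkOf (iterate φ k d) ≡ walkOf d
    -- connected components (of the graph without isolated vertices)
    c        : ℕ
    compOf   : Dart m → Fin c
    comp-sur : ∀ i → ∃ λ d → compOf d ≡ i
    comp-σ   : ∀ d → compOf (σ d) ≡ compOf d
    comp-α   : ∀ d → compOf (α d) ≡ compOf d
    comp-con : ∀ d d' → compOf d ≡ compOf d' →
               Star (λ x y → (y ≡ σ x) ⊎ (y ≡ α x)) d d'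
  compV : Fin c → ℕ
  compV i = countFin (λ v → anyDart (λ d → (tail d == v) ∧ (compOf d == i)))
  compE : Fin c → ℕ
  compE i = countFin (λ e → compOf (e , true) == i)
  compW : Fin c → ℕ
  compW i = countFin (λ j → anyDart (λ d → (walkOf d == j) ∧ (compOf d == i)))
  field
    genus0 : ∀ i → compV i + compW i ≡ compE i + 2
    f      : ℕ
    faceOfWalk : Fin w → Fin f
  Link : Fin c ⊎ Fin f → Fin c ⊎ Fin f → Set
  Link x y = ∃ λ d → ((x ≡ inj₁ (compOf d)) × (y ≡ inj₂ (faceOfWalk (walkOf d))))
               ⊎ ((y ≡ inj₁ (compOf d)) × (x ≡ inj₂ (faceOfWalk (walkOf d))))
  field
    tree-count : w + 1 ≡ c + f
    tree-conn  : ∀ x y → Star Link x y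

  faceOf : Dart m → Fin f
  faceOf d = faceOfWalk (walkOf d)

  EdgeOnFace : Fin m → Fin f → Set
  EdgeOnFace e F = (faceOf (e , true) ≡ F) ⊎ (faceOf (e , false) ≡ F)

  AdjEdges : Fin m → Fin m → Set
  AdjEdges e e' = e ≢ e' × ∃ λ b → ∃ λ b' → tail (e , b) ≡ tail (e' , b')

  AdjFaces : Fin f → Fin f → Set
  AdjFaces F F' = F ≢ F' × ∃ λ e → EdgeOnFace e F × EdgeOnFace e F'

  deg : Fin n → ℕ
  deg v = countFin (λ e → tail (e , true) == v) + countFin (λ e → tail (e , false) == v)

  Adj : Fin n → Fin n → Set
  Adj x y = ∃ λ d → tail d ≡ x × head d ≡ y

  MaxDegAtMost : ℕ → Set
  MaxDegAtMost k = ∀ v → deg v ≤ k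

  MaxDeg : ℕ → Set
  MaxDeg k = MaxDegAtMost k × ∃ λ v → deg v ≡ k

open PlaneGraph public

record EdgeFaceColouring (G : PlaneGraph) (k : ℕ) : Set where
  field
    edgeCol : Fin (m G) → Fin k
    faceCol : Fin (f G) → Fin k
    edge-edge : ∀ e e' → AdjEdges G e e' → edgeCol e ≢ edgeCol e'
    edge-face : ∀ e F → EdgeOnFace G e F → edgeCol e ≢ faceCol F
    face-face : ∀ F F' → AdjFaces G F F' → faceCol F ≢ faceCol F'

record MinimalCounterexample (G : PlaneGraph) : Set₁ where
  field
    maxDeg8       : MaxDeg G 8
    notColourable : ¬ EdgeFaceColouring G 9
    minimal       : ∀ (H : PlaneGraph) → m H < m G → MaxDegAtMost H 8 →
                    EdgeFaceColouring H 9

module Submission where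

-- If u and w are not adjacent, suppress v: delete the edge vu
-- and reroute the edge vw to join u and w.  The result H is again a simple
-- plane graph, with one edge fewer and no vertex of larger degree, so H has
-- an edge-face 9-colouring by minimality.  Keeping its colours, the only
-- uncoloured element of G is the edge vu; its colour must avoid the
-- deg_H(u) ≤ 6 edges at u in H (which include the rerouted edge, meeting vu
-- at v in G) and the two faces beside vu: at most 8 colours, so one of 9 is
-- free, contradicting that G is not colourable.

open import Defs
open import Data.Nat using (ℕ; _≤_)
open import Data.Fin using (Fin)
open import Relation.Binary.PropositionalEquality using (_≡_; _≢_)

open import Data.Nat using (zero; suc; pred; _+_; _<_; z≤n; s≤s)
open import Data.Nat.Properties
  using (≤-refl; ≤-reflexive; ≤-trans; ≤-<-trans; ≤-pred; 1+n≰n; +-assoc;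
         +-mono-≤; +-monoˡ-≤; +-monoʳ-≤; +-cancelˡ-≡; +-commutativeSemigroup; module ≤-Reasoning)
open import Data.Fin using (zero; suc; punchIn; punchOut; _↑ˡ_; _↑ʳ_; splitAt; join) renaming (_≟_ to _≟F_)
open import Data.Fin.Properties
  using (suc-injective; punchIn-injective; punchInᵢ≢i; punchIn-punchOut; punchOut-injective;
         splitAt-↑ˡ; splitAt-↑ʳ; join-splitAt)
open import Data.Bool using (Bool; true; false; not; _∧_; _∨_; if_then_else_)
open import Data.Bool.Properties using (∨-zeroʳ; not-involutive) renaming (_≟_ to _≟B_)
open import Data.Product using (∃; _×_; _,_; proj₁; proj₂)
open import Data.Product.Properties using (≡-dec)
open import Data.Sum using (_⊎_; inj₁; inj₂; [_,_]′)
open import Data.Empty using (⊥; ⊥-elim)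
open import Function using (_∘_)
open import Function.Definitions using (Injective)
open import Relation.Nullary using (¬_; yes; no; Dec)
open import Relation.Binary.Definitions using (DecidableEquality)
open import Relation.Binary.PropositionalEquality
  using (refl; sym; trans; cong; cong₂; subst; subst₂; module ≡-Reasoning)
open import Relation.Binary.Construct.Closure.ReflexiveTransitive using (Star; ε; _◅_; _◅◅_; gmap)
open import Algebra.Properties.CommutativeSemigroup +-commutativeSemigroup using (interchange; x∙yz≈y∙xz)

ι : Bool → ℕ
ι b = if b then 1 else 0

bool-ext : ∀ {a b : Bool} → (a ≡ true → b ≡ true) → (b ≡ true → a ≡ true) → a ≡ b
bool-ext {false} {false} _ _ = refl
bool-ext {false} {true}  _ g = g refl
bool-ext {true}  {false} f _ = sym (f refl)
bool-ext {true}  {true}  _ _ = refl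

∧-intro : ∀ {a b} → a ≡ true → b ≡ true → (a ∧ b) ≡ true
∧-intro refl refl = refl

∧-elim : ∀ {a b} → (a ∧ b) ≡ true → a ≡ true × b ≡ true
∧-elim {true} {true} _ = refl , refl

∨-elim-false : ∀ {a b} → (a ∨ b) ≡ false → a ≡ false × b ≡ false
∨-elim-false {false} {false} _ = refl , refl

true≢false : ∀ {a} → a ≡ true → a ≢ false
true≢false refl ()

==-sound : ∀ {k} {i j : Fin k} → (i == j) ≡ true → i ≡ j
==-sound {i = i} {j} t with i ≟F j
... | yes p = p
... | no  _ = ⊥-elim (true≢false t refl)

==-complete : ∀ {k} {i j : Fin k} → i ≡ j → (i == j) ≡ true
==-complete {i = i} {j} p with i ≟F j
... | yes _ = refl
... | no ¬p = ⊥-elim (¬p p)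

==-false : ∀ {k} {i j : Fin k} → i ≢ j → (i == j) ≡ false
==-false {i = i} {j} ¬p with i ≟F j
... | yes p = ⊥-elim (¬p p)
... | no  _ = refl

countFin-cong : ∀ {k} {p q : Fin k → Bool} → (∀ i → p i ≡ q i) → countFin p ≡ countFin q
countFin-cong {zero}  e = refl
countFin-cong {suc k} e = cong₂ _+_ (cong ι (e zero)) (countFin-cong (e ∘ suc))

countFin-none : ∀ {k} {p : Fin k → Bool} → (∀ i → p i ≡ false) → countFin p ≡ 0
countFin-none {zero}  e = refl
countFin-none {suc k} {p} e rewrite e zero = countFin-none (e ∘ suc)

countFin-single : ∀ {k} (j : Fin k) → countFin (j ==_) ≡ 1
countFin-single {suc k} zero    = cong suc (countFin-none {k} (λ i → ==-false {i = zero} {j = suc i} (λ ())))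
countFin-single {suc k} (suc j) = trans (countFin-cong suc-test) (countFin-single j)
  where
  suc-test : ∀ i → (suc j == suc i) ≡ (j == i)
  suc-test i = bool-ext (λ t → ==-complete (suc-injective (==-sound t)))
                        (λ t → ==-complete (cong suc (==-sound t)))

countFin-∨ : ∀ {k} (p q : Fin k → Bool) → countFin (λ i → p i ∨ q i) ≤ countFin p + countFin q
countFin-∨ {zero}  p q = z≤n
countFin-∨ {suc k} p q = begin
    ι (p zero ∨ q zero) + countFin (λ i → p (suc i) ∨ q (suc i))
  ≤⟨ +-mono-≤ (ι-∨ (p zero) (q zero)) (countFin-∨ (p ∘ suc) (q ∘ suc)) ⟩
    (ι (p zero) + ι (q zero)) + (countFin (p ∘ suc) + countFin (q ∘ suc))
  ≡⟨ interchange (ι (p zero)) (ι (q zero)) _ _ ⟩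
    (ι (p zero) + countFin (p ∘ suc)) + (ι (q zero) + countFin (q ∘ suc))
  ∎
  where
  open ≤-Reasoning
  ι-∨ : ∀ a b → ι (a ∨ b) ≤ ι a + ι b
  ι-∨ false b     = ≤-refl
  ι-∨ true  false = ≤-refl
  ι-∨ true  true  = s≤s z≤n

countFin-punchIn : ∀ {k} (j : Fin (suc k)) (p : Fin (suc k) → Bool) →
  countFin p ≡ ι (p j) + countFin (p ∘ punchIn j)
countFin-punchIn zero p = refl
countFin-punchIn {suc k} (suc j) p = begin
    ι (p zero) + countFin (p ∘ suc)
  ≡⟨ cong (ι (p zero) +_) (countFin-punchIn j (p ∘ suc)) ⟩
    ι (p zero) + (ι (p (suc j)) + countFin (p ∘ suc ∘ punchIn j))
  ≡⟨ x∙yz≈y∙xz (ι (p zero)) (ι (p (suc j))) (countFin (p ∘ suc ∘ punchIn j)) ⟩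
    ι (p (suc j)) + countFin (p ∘ punchIn (suc j))
  ∎
  where open ≡-Reasoning

countFin-injective : ∀ {a b} (f : Fin a → Fin b) → Injective _≡_ _≡_ f →
  (p : Fin b → Bool) → countFin (p ∘ f) ≤ countFin p
countFin-injective {zero}          f inj p = z≤n
countFin-injective {suc a} {zero}  f inj p with f zero
... | ()
countFin-injective {suc a} {suc b} f inj p = begin
    ι (p (f zero)) + countFin (p ∘ f ∘ suc)
  ≡⟨ cong (ι (p (f zero)) +_) (countFin-cong (λ i → cong p (sym (punchIn-punchOut (apart i))))) ⟩
    ι (p (f zero)) + countFin (p ∘ punchIn (f zero) ∘ rest)
  ≤⟨ +-monoʳ-≤ (ι (p (f zero))) (countFin-injective rest rest-injective (p ∘ punchIn (f zero))) ⟩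
    ι (p (f zero)) + countFin (p ∘ punchIn (f zero))
  ≡⟨ sym (countFin-punchIn (f zero) p) ⟩
    countFin p
  ∎
  where
  open ≤-Reasoning
  apart : ∀ i → f zero ≢ f (suc i)
  apart i e with inj e
  ... | ()
  rest : Fin a → Fin b
  rest i = punchOut (apart i)
  rest-injective : Injective _≡_ _≡_ rest
  rest-injective {i} {j} e with inj (punchOut-injective (apart i) (apart j) e)
  ... | refl = refl

countFin-+ : ∀ a {b} (p : Fin (a + b) → Bool) →
  countFin p ≡ countFin (p ∘ (_↑ˡ b)) + countFin (p ∘ (a ↑ʳ_))
countFin-+ zero    p = refl
countFin-+ (suc a) p = trans (cong (ι (p zero) +_) (countFin-+ a (p ∘ suc))) (sym (+-assoc (ι (p zero)) _ _))

countFin-gap : ∀ {k} (p : Fin k → Bool) → countFin p < k → ∃ λ i → p i ≡ false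
countFin-gap {suc k} p lt with p zero in e
... | false = zero , e
... | true  = let (i , q) = countFin-gap (p ∘ suc) (≤-pred lt) in suc i , q

anyFin-intro : ∀ {k} (p : Fin k → Bool) (i : Fin k) → p i ≡ true → anyFin p ≡ true
anyFin-intro p zero    e rewrite e = refl
anyFin-intro p (suc i) e rewrite anyFin-intro (p ∘ suc) i e = ∨-zeroʳ (p zero)

anyFin-elim : ∀ {k} (p : Fin k → Bool) → anyFin p ≡ true → ∃ λ i → p i ≡ true
anyFin-elim {suc k} p e with p zero in e₀
... | true  = zero , e₀
... | false = let (i , q) = anyFin-elim (p ∘ suc) e in suc i , q

countFin-image : ∀ {K k} (p : Fin k → Bool) (f : Fin k → Fin K) →
  countFin (λ c → anyFin (λ i → p i ∧ (f i == c))) ≤ countFin p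
countFin-image {K} {zero}  p f = ≤-reflexive (countFin-none {K} (λ _ → refl))
countFin-image {K} {suc k} p f = begin
    countFin (λ c → (p zero ∧ (f zero == c)) ∨ anyFin (λ i → p (suc i) ∧ (f (suc i) == c)))
  ≤⟨ countFin-∨ (λ c → p zero ∧ (f zero == c)) _ ⟩
    countFin (λ c → p zero ∧ (f zero == c)) + countFin (λ c → anyFin (λ i → p (suc i) ∧ (f (suc i) == c)))
  ≤⟨ +-mono-≤ (first (p zero)) (countFin-image (p ∘ suc) (f ∘ suc)) ⟩
    ι (p zero) + countFin (p ∘ suc)
  ∎
  where
  open ≤-Reasoning
  first : ∀ a → countFin (λ c → a ∧ (f zero == c)) ≤ ι a
  first false = ≤-reflexive (countFin-none {K} (λ _ → refl))
  first true  = ≤-reflexive (countFin-single (f zero))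

-- Counting darts.  A dart set Fin m × Bool is enumerated by Fin (m + m)
-- (first the darts (e , true), then the darts (e , false)), which lets
-- the counting lemmas over Fin be reused.

countD : ∀ {m} → (Dart m → Bool) → ℕ
countD p = countFin (λ e → p (e , true)) + countFin (λ e → p (e , false))

dartIndex : ∀ {m} → Dart m → Fin (m + m)
dartIndex {m} (e , true)  = e ↑ˡ m
dartIndex {m} (e , false) = m ↑ʳ e

indexDart : ∀ {m} → Fin (m + m) → Dart m
indexDart {m} i = [ (_, true) , (_, false) ]′ (splitAt m i)

indexDart-dartIndex : ∀ {m} (d : Dart m) → indexDart (dartIndex d) ≡ d
indexDart-dartIndex {m} (e , true)  = cong [ (_, true) , (_, false) ]′ (splitAt-↑ˡ m e m)
indexDart-dartIndex {m} (e , false) = cong [ (_, true) , (_, false) ]′ (splitAt-↑ʳ m m e)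

dartIndex-indexDart : ∀ {m} (i : Fin (m + m)) → dartIndex (indexDart {m} i) ≡ i
dartIndex-indexDart {m} i = trans (by-cases (splitAt m i)) (join-splitAt m m i)
  where
  by-cases : ∀ s → dartIndex ([ (_, true) , (_, false) ]′ s) ≡ join m m s
  by-cases (inj₁ e) = refl
  by-cases (inj₂ e) = refl

dartIndex-injective : ∀ {m} → Injective _≡_ _≡_ (dartIndex {m})
dartIndex-injective {m} {d} {d'} e =
  trans (sym (indexDart-dartIndex d)) (trans (cong indexDart e) (indexDart-dartIndex d'))

indexDart-injective : ∀ {m} → Injective _≡_ _≡_ (indexDart {m})
indexDart-injective {m} {i} {j} e =
  trans (sym (dartIndex-indexDart {m} i)) (trans (cong dartIndex e) (dartIndex-indexDart {m} j))

countD-as-countFin : ∀ {m} (p : Dart m → Bool) → countD p ≡ countFin (p ∘ indexDart {m})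
countD-as-countFin {m} p = sym (trans (countFin-+ m (p ∘ indexDart))
  (cong₂ _+_ (countFin-cong (λ e → cong p (indexDart-dartIndex (e , true))))
             (countFin-cong (λ e → cong p (indexDart-dartIndex (e , false))))))

countD-injective : ∀ {a b} (f : Dart a → Dart b) → Injective _≡_ _≡_ f →
  (p : Dart b → Bool) → countD (p ∘ f) ≤ countD p
countD-injective f inj p = begin
    countD (p ∘ f)
  ≡⟨ countD-as-countFin (p ∘ f) ⟩
    countFin (p ∘ f ∘ indexDart)
  ≡⟨ countFin-cong (λ i → cong p (sym (indexDart-dartIndex (f (indexDart i))))) ⟩
    countFin (p ∘ indexDart ∘ F)
  ≤⟨ countFin-injective F F-injective (p ∘ indexDart) ⟩
    countFin (p ∘ indexDart)
  ≡⟨ countD-as-countFin p ⟨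
    countD p
  ∎
  where
  open ≤-Reasoning
  F = dartIndex ∘ f ∘ indexDart
  F-injective : Injective _≡_ _≡_ F
  F-injective = indexDart-injective ∘ inj ∘ dartIndex-injective

countD-three : ∀ {m} (p : Dart m → Bool) (a b c : Dart m) → a ≢ b → a ≢ c → b ≢ c →
  p a ≡ true → p b ≡ true → p c ≡ true → 3 ≤ countD p
countD-three p a b c a≢b a≢c b≢c pa pb pc = begin
    3
  ≡⟨ countFin-cong {p = λ _ → true} all-hold ⟩
    countFin (p ∘ indexDart ∘ dartIndex ∘ pick)
  ≤⟨ countFin-injective (dartIndex ∘ pick) index-injective (p ∘ indexDart) ⟩
    countFin (p ∘ indexDart)
  ≡⟨ countD-as-countFin p ⟨
    countD p
  ∎
  where
  open ≤-Reasoning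
  pick : Fin 3 → Dart _
  pick zero             = a
  pick (suc zero)       = b
  pick (suc (suc zero)) = c
  all-hold : ∀ i → true ≡ p (indexDart (dartIndex (pick i)))
  all-hold i = sym (trans (cong p (indexDart-dartIndex (pick i))) (holds i))
    where
    holds : ∀ i → p (pick i) ≡ true
    holds zero             = pa
    holds (suc zero)       = pb
    holds (suc (suc zero)) = pc
  pick-injective : Injective _≡_ _≡_ pick
  pick-injective {zero}             {zero}             _ = refl
  pick-injective {zero}             {suc zero}         e = ⊥-elim (a≢b e)
  pick-injective {zero}             {suc (suc zero)}   e = ⊥-elim (a≢c e)
  pick-injective {suc zero}         {zero}             e = ⊥-elim (a≢b (sym e))
  pick-injective {suc zero}         {suc zero}         _ = refl
  pick-injective {suc zero}         {suc (suc zero)}   e = ⊥-elim (b≢c e)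
  pick-injective {suc (suc zero)}   {zero}             e = ⊥-elim (a≢c (sym e))
  pick-injective {suc (suc zero)}   {suc zero}         e = ⊥-elim (b≢c (sym e))
  pick-injective {suc (suc zero)}   {suc (suc zero)}   _ = refl
  index-injective : Injective _≡_ _≡_ (dartIndex ∘ pick)
  index-injective = pick-injective ∘ dartIndex-injective

anyDart-intro : ∀ {m} (p : Dart m → Bool) (d : Dart m) → p d ≡ true → anyDart p ≡ true
anyDart-intro p (e , true)  t rewrite anyFin-intro (λ i → p (i , true)) e t = refl
anyDart-intro p (e , false) t rewrite anyFin-intro (λ i → p (i , false)) e t =
  ∨-zeroʳ (anyFin (λ i → p (i , true)))

anyDart-elim : ∀ {m} (p : Dart m → Bool) → anyDart p ≡ true → ∃ λ d → p d ≡ true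
anyDart-elim p t with anyFin (λ i → p (i , true)) in e
... | true  = let (i , q) = anyFin-elim (λ i → p (i , true)) e in (i , true) , q
... | false = let (i , q) = anyFin-elim (λ i → p (i , false)) t in (i , false) , q

anyDart-equiv : ∀ {a b} (p : Dart a → Bool) (q : Dart b → Bool) →
  (∀ d → p d ≡ true → ∃ λ d' → q d' ≡ true) → (∀ d' → q d' ≡ true → ∃ λ d → p d ≡ true) →
  anyDart p ≡ anyDart q
anyDart-equiv p q p⇒q q⇒p = bool-ext (witness p q p⇒q) (witness q p q⇒p)
  where
  witness : ∀ {a b} (p : Dart a → Bool) (q : Dart b → Bool) →
    (∀ d → p d ≡ true → ∃ λ d' → q d' ≡ true) → anyDart p ≡ true → anyDart q ≡ true
  witness p q p⇒q t = let (d , pd) = anyDart-elim p t ; (d' , qd') = p⇒q d pd in anyDart-intro q d' qd'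

countD-image : ∀ {K m} (p : Dart m → Bool) (f : Dart m → Fin K) →
  countFin (λ c → anyDart (λ d → p d ∧ (f d == c))) ≤ countD p
countD-image p f = ≤-trans
  (countFin-∨ (λ c → anyFin (λ i → p (i , true) ∧ (f (i , true) == c)))
              (λ c → anyFin (λ i → p (i , false) ∧ (f (i , false) == c))))
  (+-mono-≤ (countFin-image (λ i → p (i , true)) (λ i → f (i , true)))
            (countFin-image (λ i → p (i , false)) (λ i → f (i , false))))

_≟D_ : ∀ {m} → DecidableEquality (Dart m)
_≟D_ = ≡-dec _≟F_ _≟B_

αα : ∀ {m} (d : Dart m) → α (α d) ≡ d
αα (e , b) = cong (e ,_) (not-involutive b)

α≢ : ∀ {m} (d : Dart m) → α d ≢ d
α≢ (e , true)  ()
α≢ (e , false) ()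

sameEdge : ∀ {m} (d d' : Dart m) → proj₁ d' ≡ proj₁ d → d' ≡ d ⊎ d' ≡ α d
sameEdge (e , true)  (.e , true)  refl = inj₁ refl
sameEdge (e , false) (.e , false) refl = inj₁ refl
sameEdge (e , true)  (.e , false) refl = inj₂ refl
sameEdge (e , false) (.e , true)  refl = inj₂ refl

-- skip k : Fin (pred N) → Fin N enumerates Fin N without k; it is how the
-- edges (and vertices) of a graph are indexed after removing one of them.
skip : ∀ {N} → Fin N → Fin (pred N) → Fin N
skip {suc N} k = punchIn k

skip-injective : ∀ {N} (k : Fin N) → Injective _≡_ _≡_ (skip k)
skip-injective {suc N} k = punchIn-injective k _ _

skip≢ : ∀ {N} (k : Fin N) i → skip k i ≢ k
skip≢ {suc N} k i = punchInᵢ≢i k i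

skip-onto : ∀ {N} (k j : Fin N) → j ≢ k → ∃ λ i → skip k i ≡ j
skip-onto {suc N} k j j≢k = punchOut (j≢k ∘ sym) , punchIn-punchOut (j≢k ∘ sym)

countFin-skip : ∀ {N} (k : Fin N) (p : Fin N → Bool) → countFin p ≡ ι (p k) + countFin (p ∘ skip k)
countFin-skip {suc N} k p = countFin-punchIn k p

pred< : ∀ {N} → Fin N → pred N < N
pred< {suc N} _ = ≤-refl

iterate-suc : ∀ {A : Set} (f : A → A) k x → iterate f (suc k) x ≡ iterate f k (f x)
iterate-suc f zero    x = refl
iterate-suc f (suc k) x = cong f (iterate-suc f k x)

iterate-fixed : ∀ {A : Set} (f : A → A) x → f x ≡ x → ∀ k → iterate f k x ≡ x
iterate-fixed f x e zero    = refl
iterate-fixed f x e (suc k) = trans (cong f (iterate-fixed f x e k)) e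

adjacent? : (G : PlaneGraph) (x y : Fin (n G)) → Dec (Adj G x y)
adjacent? G x y = decide (anyDart test) refl
  where
  test : Dart (m G) → Bool
  test d = (tail G d == x) ∧ (head G d == y)
  decide : ∀ b → anyDart test ≡ b → Dec (Adj G x y)
  decide true  e = let (d , t) = anyDart-elim test e ; (tx , hy) = ∧-elim t in
                   yes (d , ==-sound tx , ==-sound hy)
  decide false e = no λ (d , tx , hy) →
                   true≢false (anyDart-intro test d (∧-intro (==-complete tx) (==-complete hy))) e

-- Suppressing a degree-2 vertex.
--
-- The plane graph H has the same vertices, faces,
-- facial walks and components as G; its edges are those of G except e₁
-- (the edge of d₁), and the edge e₂ of d₂ is rerouted to run from u to w.
-- Concretely, H-dart x corresponds to the G-dart embed x, which is x itself
-- (renumbered) except that the dart of e₂ leaving v is replaced by the dart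
-- α d₁ leaving u.  So embed is a bijection onto the G-darts not at v, and
-- all structure of H is transported from G along it.

module Suppression (G : PlaneGraph) (v u w : Fin (n G)) (d₁ d₂ : Dart (m G))
  (t₁ : tail G d₁ ≡ v) (h₁ : head G d₁ ≡ u) (t₂ : tail G d₂ ≡ v) (h₂ : head G d₂ ≡ w)
  (deg-v : deg G v ≡ 2) (u≢w : u ≢ w) (u≁w : ¬ Adj G u w) where

  module G = PlaneGraph G

  M  = m G
  M' = pred M
  e₁ = proj₁ d₁
  e₂ = proj₁ d₂

  OffV : Dart M → Set
  OffV d = G.tail d ≢ v

  at-v? : ∀ y → G.tail y ≡ v ⊎ OffV y
  at-v? y with G.tail y ≟F v
  ... | yes tv  = inj₁ tv
  ... | no  off = inj₂ off

  u≢v : u ≢ v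
  u≢v e = G.noLoop d₁ (trans t₁ (sym (trans h₁ e)))

  d₁≢d₂ : d₁ ≢ d₂
  d₁≢d₂ e = u≢w (trans (sym h₁) (trans (cong G.head e) h₂))

  e₂≢e₁ : e₂ ≢ e₁
  e₂≢e₁ e with sameEdge d₁ d₂ e
  ... | inj₁ p = d₁≢d₂ (sym p)
  ... | inj₂ p = u≢v (trans (sym h₁) (trans (cong G.tail (sym p)) t₂))

  darts-at-v : ∀ d → G.tail d ≡ v → d ≡ d₁ ⊎ d ≡ d₂
  darts-at-v d td with d ≟D d₁ | d ≟D d₂
  ... | yes p | _     = inj₁ p
  ... | no _  | yes q = inj₂ q
  ... | no p  | no q  = ⊥-elim (1+n≰n (≤-trans
          (countD-three (λ x → G.tail x == v) d₁ d₂ d d₁≢d₂ (p ∘ sym) (q ∘ sym)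
                        (==-complete t₁) (==-complete t₂) (==-complete td))
          (≤-reflexive deg-v)))

  σ-injective : ∀ {x y} → G.σ x ≡ G.σ y → x ≡ y
  σ-injective {x} {y} e = trans (sym (G.σ⁻¹σ x)) (trans (cong G.σ⁻¹ e) (G.σ⁻¹σ y))

  σ-d₁ : G.σ d₁ ≡ d₂
  σ-d₁ with darts-at-v (G.σ d₁) (trans (G.σ-tail d₁) t₁)
  ... | inj₂ p = p
  ... | inj₁ p = let (k , q) = G.σ-cyc d₁ d₂ (trans t₁ (sym t₂)) in
                 ⊥-elim (d₁≢d₂ (trans (sym (iterate-fixed G.σ d₁ p k)) q))

  σ-d₂ : G.σ d₂ ≡ d₁
  σ-d₂ with darts-at-v (G.σ d₂) (trans (G.σ-tail d₂) t₂)
  ... | inj₁ p = p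
  ... | inj₂ p = ⊥-elim (d₁≢d₂ (σ-injective (trans σ-d₁ (sym p))))

  φ-αd₁ : G.φ (α d₁) ≡ d₂
  φ-αd₁ = trans (cong G.σ (αα d₁)) σ-d₁

  φ-αd₂ : G.φ (α d₂) ≡ d₁
  φ-αd₂ = trans (cong G.σ (αα d₂)) σ-d₂

  walk-φ : ∀ d → G.walkOf (G.φ d) ≡ G.walkOf d
  walk-φ d = G.orb-walk d 1

  comp-φ : ∀ d → G.compOf (G.φ d) ≡ G.compOf d
  comp-φ d = trans (G.comp-σ (α d)) (G.comp-α d)

  walk-d₂ : G.walkOf d₂ ≡ G.walkOf (α d₁)
  walk-d₂ = trans (cong G.walkOf (sym φ-αd₁)) (walk-φ (α d₁))

  walk-d₁ : G.walkOf d₁ ≡ G.walkOf (α d₂)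
  walk-d₁ = trans (cong G.walkOf (sym φ-αd₂)) (walk-φ (α d₂))

  comp-d₂ : G.compOf d₂ ≡ G.compOf d₁
  comp-d₂ = trans (cong G.compOf (sym σ-d₁)) (G.comp-σ d₁)

  OffV-σ : ∀ {d} → OffV d → OffV (G.σ d)
  OffV-σ {d} off e = off (trans (sym (G.σ-tail d)) e)

  OffV-σ⁻¹ : ∀ {d} → OffV d → OffV (G.σ⁻¹ d)
  OffV-σ⁻¹ {d} off e = off (trans (cong G.tail (sym (G.σσ⁻¹ d))) (trans (G.σ-tail (G.σ⁻¹ d)) e))

  φ-leaves-v : ∀ {d} → G.tail d ≡ v → OffV (G.φ d)
  φ-leaves-v {d} tv e = G.noLoop d (trans tv (sym (trans (sym (G.σ-tail (α d))) e)))

  OffV-αd₁ : OffV (α d₁)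
  OffV-αd₁ e = u≢v (trans (sym h₁) e)

  lift : Dart M' → Dart M
  lift (i , b) = (skip e₁ i , b)

  lift-injective : ∀ {x y} → lift x ≡ lift y → x ≡ y
  lift-injective {i , b} {j , b'} e with cong proj₂ e
  ... | refl = cong (_, b) (skip-injective e₁ (cong proj₁ e))

  lift≢d₁ : ∀ x → lift x ≢ d₁
  lift≢d₁ (i , b) e = skip≢ e₁ i (cong proj₁ e)

  lift≢αd₁ : ∀ x → lift x ≢ α d₁
  lift≢αd₁ (i , b) e = skip≢ e₁ i (cong proj₁ e)

  lift-at-v : ∀ x → G.tail (lift x) ≡ v → lift x ≡ d₂
  lift-at-v x tv = [ (λ r → ⊥-elim (lift≢d₁ x r)) , (λ r → r) ]′ (darts-at-v (lift x) tv)

  embed : Dart M' → Dart M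
  embed x with lift x ≟D d₂
  ... | yes _ = α d₁
  ... | no  _ = lift x

  embed-cases : ∀ x → (lift x ≢ d₂ × embed x ≡ lift x) ⊎ (lift x ≡ d₂ × embed x ≡ α d₁)
  embed-cases x with lift x ≟D d₂
  ... | yes p = inj₂ (p , refl)
  ... | no  p = inj₁ (p , refl)

  embed-off-v : ∀ x → OffV (embed x)
  embed-off-v x with embed-cases x
  ... | inj₂ (_ , q) = subst OffV (sym q) OffV-αd₁
  ... | inj₁ (p , q) = λ e → p (lift-at-v x (trans (cong G.tail (sym q)) e))

  walk-embed : ∀ x → G.walkOf (embed x) ≡ G.walkOf (lift x)
  walk-embed x with embed-cases x
  ... | inj₁ (_ , q) = cong G.walkOf q
  ... | inj₂ (p , q) = trans (cong G.walkOf q) (trans (sym walk-d₂) (cong G.walkOf (sym p)))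

  embed-injective : ∀ {x y} → embed x ≡ embed y → x ≡ y
  embed-injective {x} {y} e with embed-cases x | embed-cases y
  ... | inj₁ (_ , p) | inj₁ (_ , q) = lift-injective (trans (sym p) (trans e q))
  ... | inj₂ (p , _) | inj₂ (q , _) = lift-injective (trans p (sym q))
  ... | inj₁ (_ , p) | inj₂ (_ , q) = ⊥-elim (lift≢αd₁ x (trans (sym p) (trans e q)))
  ... | inj₂ (_ , p) | inj₁ (_ , q) = ⊥-elim (lift≢αd₁ y (trans (sym q) (trans (sym e) p)))

  i₂ : Fin M'
  i₂ = proj₁ (skip-onto e₁ e₂ e₂≢e₁)

  D₂ : Dart M'
  D₂ = (i₂ , proj₂ d₂)

  lift-D₂ : lift D₂ ≡ d₂
  lift-D₂ = cong (_, proj₂ d₂) (proj₂ (skip-onto e₁ e₂ e₂≢e₁))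

  embed-D₂ : embed D₂ ≡ α d₁
  embed-D₂ with embed-cases D₂
  ... | inj₁ (p , _) = ⊥-elim (p lift-D₂)
  ... | inj₂ (_ , q) = q

  embed-αD₂ : embed (α D₂) ≡ α d₂
  embed-αD₂ with embed-cases (α D₂)
  ... | inj₁ (_ , q) = trans q (cong α lift-D₂)
  ... | inj₂ (p , _) = ⊥-elim (α≢ d₂ (trans (cong α (sym lift-D₂)) p))

  embed-onto : ∀ y → OffV y → ∃ λ x → embed x ≡ y
  embed-onto y off with y ≟D α d₁
  ... | yes p = D₂ , trans embed-D₂ (sym p)
  ... | no p with proj₁ y ≟F e₁
  ...   | yes q = ⊥-elim ([ (λ r → off (trans (cong G.tail r) t₁)) , p ]′ (sameEdge d₁ y q))
  ...   | no q with skip-onto e₁ (proj₁ y) q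
  ...     | (i , r) with embed-cases (i , proj₂ y)
  ...       | inj₁ (_ , s) = (i , proj₂ y) , trans s (cong (_, proj₂ y) r)
  ...       | inj₂ (s , _) = ⊥-elim (off (trans (cong G.tail (trans (sym (cong (_, proj₂ y) r)) s)) t₂))

  unembed : ∀ y → OffV y → Dart M'
  unembed y off = proj₁ (embed-onto y off)

  embed-unembed : ∀ y off → embed (unembed y off) ≡ y
  embed-unembed y off = proj₂ (embed-onto y off)

  Rerouted : Dart M' → Set
  Rerouted x = (embed x ≡ α d₁ × embed (α x) ≡ α d₂) ⊎ (embed x ≡ α d₂ × embed (α x) ≡ α d₁)

  Ordinary : Dart M' → Set
  Ordinary x = embed (α x) ≡ α (embed x)

  alpha-cases : ∀ x → Rerouted x ⊎ Ordinary x
  alpha-cases x with embed-cases x | embed-cases (α x)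
  ... | inj₂ (p , q) | inj₁ (_ , s) = inj₁ (inj₁ (q , trans s (cong α p)))
  ... | inj₂ (p , q) | inj₂ (r , _) = ⊥-elim (α≢ d₂ (trans (cong α (sym p)) r))
  ... | inj₁ (p , q) | inj₂ (r , s) = inj₁ (inj₂ (trans q (trans (sym (αα (lift x))) (cong α r)) , s))
  ... | inj₁ (p , q) | inj₁ (r , s) = inj₂ (trans s (cong α (sym q)))

  tailH : Dart M' → Fin (n G)
  tailH x = G.tail (embed x)

  rerouted-ends : ∀ x → Rerouted x →
    (tailH x ≡ u × tailH (α x) ≡ w) ⊎ (tailH x ≡ w × tailH (α x) ≡ u)
  rerouted-ends x (inj₁ (p , q)) = inj₁ (trans (cong G.tail p) h₁ , trans (cong G.tail q) h₂)
  rerouted-ends x (inj₂ (p , q)) = inj₂ (trans (cong G.tail p) h₂ , trans (cong G.tail q) h₁)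

  ordinary-not-uw : ∀ x → Ordinary x → tailH x ≡ u → tailH (α x) ≢ w
  ordinary-not-uw x o tu tw = u≁w (embed x , tu , trans (cong G.tail (sym o)) tw)

  ordinary-α : ∀ {x} → Ordinary x → Ordinary (α x)
  ordinary-α {x} o = trans (cong embed (αα x)) (trans (sym (αα (embed x))) (cong α (sym o)))

  ordinary-not-wu : ∀ x → Ordinary x → tailH x ≡ w → tailH (α x) ≢ u
  ordinary-not-wu x o tw tu = ordinary-not-uw (α x) (ordinary-α o) tu (trans (cong tailH (αα x)) tw)

  σH : Dart M' → Dart M'
  σH x = unembed (G.σ (embed x)) (OffV-σ (embed-off-v x))

  σ⁻¹H : Dart M' → Dart M'
  σ⁻¹H x = unembed (G.σ⁻¹ (embed x)) (OffV-σ⁻¹ (embed-off-v x))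

  embed-σ : ∀ x → embed (σH x) ≡ G.σ (embed x)
  embed-σ x = embed-unembed _ _

  embed-σ⁻¹ : ∀ x → embed (σ⁻¹H x) ≡ G.σ⁻¹ (embed x)
  embed-σ⁻¹ x = embed-unembed _ _

  σσ⁻¹H : ∀ x → σH (σ⁻¹H x) ≡ x
  σσ⁻¹H x = embed-injective (trans (embed-σ (σ⁻¹H x)) (trans (cong G.σ (embed-σ⁻¹ x)) (G.σσ⁻¹ (embed x))))

  σ⁻¹σH : ∀ x → σ⁻¹H (σH x) ≡ x
  σ⁻¹σH x = embed-injective (trans (embed-σ⁻¹ (σH x)) (trans (cong G.σ⁻¹ (embed-σ x)) (G.σ⁻¹σ (embed x))))

  σ-tailH : ∀ x → tailH (σH x) ≡ tailH x
  σ-tailH x = trans (cong G.tail (embed-σ x)) (G.σ-tail (embed x))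

  embed-iterate-σ : ∀ k x → embed (iterate σH k x) ≡ iterate G.σ k (embed x)
  embed-iterate-σ zero    x = refl
  embed-iterate-σ (suc k) x = trans (embed-σ (iterate σH k x)) (cong G.σ (embed-iterate-σ k x))

  σ-cycH : ∀ x y → tailH x ≡ tailH y → ∃ λ k → iterate σH k x ≡ y
  σ-cycH x y e = let (k , p) = G.σ-cyc (embed x) (embed y) e in
                 k , embed-injective (trans (embed-iterate-σ k x) p)

  -- H is simple: the rerouted edge is no loop as u ≠ w, and is parallel to
  -- no other edge as u and w are not adjacent in G.

  noLoopH : ∀ x → tailH x ≢ tailH (α x)
  noLoopH x e with alpha-cases x
  ... | inj₂ o = G.noLoop (embed x) (trans e (cong G.tail o))
  ... | inj₁ r with rerouted-ends x r
  ...   | inj₁ (tu , tw) = u≢w (trans (sym tu) (trans e tw))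
  ...   | inj₂ (tw , tu) = u≢w (trans (sym tu) (trans (sym e) tw))

  noParallelH : ∀ x y → tailH x ≡ tailH y → tailH (α x) ≡ tailH (α y) → x ≡ y
  noParallelH x y et eh = embed-injective (by-cases (alpha-cases x) (alpha-cases y))
    where
    ordinary-vs-rerouted : ∀ a b → Ordinary a → Rerouted b →
      tailH a ≡ tailH b → tailH (α a) ≡ tailH (α b) → ⊥
    ordinary-vs-rerouted a b o r ea eb with rerouted-ends b r
    ... | inj₁ (tu , tw) = ordinary-not-uw a o (trans ea tu) (trans eb tw)
    ... | inj₂ (tw , tu) = ordinary-not-wu a o (trans ea tw) (trans eb tu)
    by-cases : Rerouted x ⊎ Ordinary x → Rerouted y ⊎ Ordinary y → embed x ≡ embed y
    by-cases (inj₂ ox) (inj₂ oy) =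
      G.noParallel (embed x) (embed y) et (trans (cong G.tail (sym ox)) (trans eh (cong G.tail oy)))
    by-cases (inj₂ ox) (inj₁ ry) = ⊥-elim (ordinary-vs-rerouted x y ox ry et eh)
    by-cases (inj₁ rx) (inj₂ oy) = ⊥-elim (ordinary-vs-rerouted y x oy rx (sym et) (sym eh))
    by-cases (inj₁ (inj₁ (p , _))) (inj₁ (inj₁ (q , _))) = trans p (sym q)
    by-cases (inj₁ (inj₂ (p , _))) (inj₁ (inj₂ (q , _))) = trans p (sym q)
    by-cases (inj₁ (inj₁ (p , _))) (inj₁ (inj₂ (q , _))) =
      ⊥-elim (u≢w (trans (sym h₁) (trans (cong G.tail (sym p)) (trans et (trans (cong G.tail q) h₂)))))
    by-cases (inj₁ (inj₂ (p , _))) (inj₁ (inj₁ (q , _))) =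
      ⊥-elim (u≢w (trans (sym h₁) (trans (cong G.tail (sym q)) (trans (sym et) (trans (cong G.tail p) h₂)))))

  -- Face tracing in H: φH agrees with G's φ, except that the detour
  -- α d₁ → d₂ → (beyond) or α d₂ → d₁ → (beyond) through v is skipped.

  φH : Dart M' → Dart M'
  φH x = σH (α x)

  PhiStep : Dart M' → Set
  PhiStep x = embed (φH x) ≡ G.φ (embed x)
            ⊎ (G.tail (G.φ (embed x)) ≡ v × embed (φH x) ≡ G.φ (G.φ (embed x)))

  phi-step : ∀ x → PhiStep x
  phi-step x with alpha-cases x
  ... | inj₂ o = inj₁ (trans (embed-σ (α x)) (cong G.σ o))
  ... | inj₁ (inj₁ (p , q)) = inj₂ (trans (cong (G.tail ∘ G.φ) p) (trans (cong G.tail φ-αd₁) t₂) ,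
          trans (embed-σ (α x)) (trans (cong G.σ q) (cong G.φ (sym (trans (cong G.φ p) φ-αd₁)))))
  ... | inj₁ (inj₂ (p , q)) = inj₂ (trans (cong (G.tail ∘ G.φ) p) (trans (cong G.tail φ-αd₂) t₁) ,
          trans (embed-σ (α x)) (trans (cong G.σ q) (cong G.φ (sym (trans (cong G.φ p) φ-αd₂)))))

  walkH : Dart M' → Fin G.w
  walkH x = G.walkOf (embed x)

  orb-walkH : ∀ x k → walkH (iterate φH k x) ≡ walkH x
  orb-walkH x zero    = refl
  orb-walkH x (suc k) = trans (one-step (iterate φH k x) (phi-step (iterate φH k x))) (orb-walkH x k)
    where
    one-step : ∀ y → PhiStep y → walkH (φH y) ≡ walkH y
    one-step y (inj₁ e)       = trans (cong G.walkOf e) (G.orb-walk (embed y) 1)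
    one-step y (inj₂ (_ , e)) = trans (cong G.walkOf e) (G.orb-walk (embed y) 2)

  pullback-orbit : ∀ k x y → iterate G.φ k (embed x) ≡ embed y → ∃ λ k' → iterate φH k' x ≡ y
  pullback-orbit zero    x y e = 0 , embed-injective e
  pullback-orbit (suc k) x y e = continue k (phi-step x) (trans (sym (iterate-suc G.φ k (embed x))) e)
    where
    after : ∀ k → (∃ λ k' → iterate φH k' (φH x) ≡ y) → ∃ λ k' → iterate φH k' x ≡ y
    after k (k' , r) = suc k' , trans (iterate-suc φH k' x) r
    continue : ∀ k → PhiStep x → iterate G.φ k (G.φ (embed x)) ≡ embed y → ∃ λ k' → iterate φH k' x ≡ y
    continue k (inj₁ s) e = after k (pullback-orbit k (φH x) y (trans (cong (iterate G.φ k) s) e))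
    continue zero (inj₂ (tv , _)) e = ⊥-elim (embed-off-v y (trans (cong G.tail (sym e)) tv))
    continue (suc k) (inj₂ (_ , s)) e = after k (pullback-orbit k (φH x) y
      (trans (cong (iterate G.φ k) s) (trans (sym (iterate-suc G.φ k (G.φ (embed x)))) e)))

  walk-orbH : ∀ x y → walkH x ≡ walkH y → ∃ λ k → iterate φH k x ≡ y
  walk-orbH x y e = let (k , p) = G.walk-orb (embed x) (embed y) e in pullback-orbit k x y p

  compH : Dart M' → Fin G.c
  compH x = G.compOf (embed x)

  -- Every G-dart shares its facial walk and component with some H-dart
  -- (a dart at v is represented by the next dart of its walk).
  representative : ∀ d → ∃ λ x → compH x ≡ G.compOf d × walkH x ≡ G.walkOf d
  representative d with at-v? d
  ... | inj₂ off = unembed d off , cong G.compOf (embed-unembed d off) , cong G.walkOf (embed-unembed d off)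
  ... | inj₁ tv = unembed (G.φ d) (φ-leaves-v tv) ,
                 trans (cong G.compOf (embed-unembed _ _)) (comp-φ d) ,
                 trans (cong G.walkOf (embed-unembed _ _)) (walk-φ d)

  walk-surH : ∀ j → ∃ λ x → walkH x ≡ j
  walk-surH j = let (d , p) = G.walk-sur j ; (x , _ , q) = representative d in x , trans q p

  comp-surH : ∀ i → ∃ λ x → compH x ≡ i
  comp-surH i = let (d , p) = G.comp-sur i ; (x , q , _) = representative d in x , trans q p

  comp-σH : ∀ x → compH (σH x) ≡ compH x
  comp-σH x = trans (cong G.compOf (embed-σ x)) (G.comp-σ (embed x))

  comp-αd₁≡αd₂ : G.compOf (α d₁) ≡ G.compOf (α d₂)
  comp-αd₁≡αd₂ = trans (G.comp-α d₁) (trans (sym comp-d₂) (sym (G.comp-α d₂)))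

  comp-αH : ∀ x → compH (α x) ≡ compH x
  comp-αH x with alpha-cases x
  ... | inj₂ o = trans (cong G.compOf o) (G.comp-α (embed x))
  ... | inj₁ (inj₁ (p , q)) = trans (cong G.compOf q) (trans (sym comp-αd₁≡αd₂) (cong G.compOf (sym p)))
  ... | inj₁ (inj₂ (p , q)) = trans (cong G.compOf q) (trans comp-αd₁≡αd₂ (cong G.compOf (sym p)))

  -- Connectivity of components: project G-darts to H-darts (darts at v go
  -- to D₂) so that every σ/α step in G becomes at most one step in H.

  StepG : Dart M → Dart M → Set
  StepG x y = (y ≡ G.σ x) ⊎ (y ≡ α x)

  StepH : Dart M' → Dart M' → Set
  StepH x y = (y ≡ σH x) ⊎ (y ≡ α x)

  project : Dart M → Dart M'
  project y with G.tail y ≟F v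
  ... | yes _   = D₂
  ... | no  off = unembed y off

  embed-project : ∀ y → OffV y → embed (project y) ≡ y
  embed-project y off with G.tail y ≟F v
  ... | yes tv   = ⊥-elim (off tv)
  ... | no  off′ = embed-unembed y off′

  project-at-v : ∀ y → G.tail y ≡ v → project y ≡ D₂
  project-at-v y tv with G.tail y ≟F v
  ... | yes _   = refl
  ... | no  off = ⊥-elim (off tv)

  project-embed : ∀ x → project (embed x) ≡ x
  project-embed x = embed-injective (embed-project (embed x) (embed-off-v x))

  ≡⇒Star : ∀ {x y} → x ≡ y → Star StepH x y
  ≡⇒Star refl = ε

  α-Star : ∀ {x y} → y ≡ α x → Star StepH x y
  α-Star e = inj₂ e ◅ ε

  reverse-at-v : ∀ y → G.tail y ≡ v → project (α y) ≡ D₂ ⊎ project (α y) ≡ α D₂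
  reverse-at-v y tv with darts-at-v y tv
  ... | inj₁ refl = inj₁ (trans (cong project (sym embed-D₂)) (project-embed D₂))
  ... | inj₂ refl = inj₂ (trans (cong project (sym embed-αD₂)) (project-embed (α D₂)))

  near-D₂ : ∀ {x} → x ≡ D₂ ⊎ x ≡ α D₂ → Star StepH D₂ x × Star StepH x D₂
  near-D₂ (inj₁ refl) = ε , ε
  near-D₂ (inj₂ refl) = α-Star refl , α-Star (sym (αα D₂))

  project-σ-step : ∀ y → Star StepH (project y) (project (G.σ y))
  project-σ-step y with at-v? y
  ... | inj₁ tv  = ≡⇒Star (trans (project-at-v y tv) (sym (project-at-v (G.σ y) (trans (G.σ-tail y) tv))))
  ... | inj₂ off = inj₁ (embed-injective (begin
          embed (project (G.σ y))      ≡⟨ embed-project (G.σ y) (OffV-σ off) ⟩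
          G.σ y                        ≡⟨ cong G.σ (sym (embed-project y off)) ⟩
          G.σ (embed (project y))      ≡⟨ sym (embed-σ (project y)) ⟩
          embed (σH (project y))       ∎)) ◅ ε
    where open ≡-Reasoning

  project-α-step : ∀ y → Star StepH (project y) (project (α y))
  project-α-step y with at-v? y | at-v? (α y)
  ... | inj₁ tv | _ = subst (λ z → Star StepH z (project (α y))) (sym (project-at-v y tv))
                       (proj₁ (near-D₂ (reverse-at-v y tv)))
  ... | inj₂ _ | inj₁ tv = subst₂ (Star StepH) (cong project (αα y)) (sym (project-at-v (α y) tv))
                          (proj₂ (near-D₂ (reverse-at-v (α y) tv)))
  ... | inj₂ off | inj₂ off′ with alpha-cases (project y)
  ...   | inj₂ o = α-Star (embed-injective (begin
            embed (project (α y))        ≡⟨ embed-project (α y) off′ ⟩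
            α y                          ≡⟨ cong α (sym (embed-project y off)) ⟩
            α (embed (project y))        ≡⟨ sym o ⟩
            embed (α (project y))        ∎))
    where open ≡-Reasoning
  ...   | inj₁ r = ⊥-elim (off′ (reverse-at-v-from r))
    where
    -- a rerouted dart is α d₁ or α d₂, whose reversal lies at v
    reversal-of : ∀ d → G.tail d ≡ v → embed (project y) ≡ α d → G.tail (α y) ≡ v
    reversal-of d td p =
      trans (cong (G.tail ∘ α) (trans (sym (embed-project y off)) p)) (trans (cong G.tail (αα d)) td)
    reverse-at-v-from : Rerouted (project y) → G.tail (α y) ≡ v
    reverse-at-v-from (inj₁ (p , _)) = reversal-of d₁ t₁ p
    reverse-at-v-from (inj₂ (p , _)) = reversal-of d₂ t₂ p

  project-star : ∀ {y y'} → Star StepG y y' → Star StepH (project y) (project y')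
  project-star ε = ε
  project-star {y} (inj₁ refl ◅ ss) = project-σ-step y ◅◅ project-star ss
  project-star {y} (inj₂ refl ◅ ss) = project-α-step y ◅◅ project-star ss

  comp-conH : ∀ x y → compH x ≡ compH y → Star StepH x y
  comp-conH x y e = subst₂ (Star StepH) (project-embed x) (project-embed y)
                      (project-star (G.comp-con (embed x) (embed y) e))

  -- The component/face incidence tree is unchanged, since every facial
  -- walk and every component of G is still represented in H.

  LinkH : Fin G.c ⊎ Fin G.f → Fin G.c ⊎ Fin G.f → Set
  LinkH x y = ∃ λ d → ((x ≡ inj₁ (compH d)) × (y ≡ inj₂ (G.faceOfWalk (walkH d))))
                    ⊎ ((y ≡ inj₁ (compH d)) × (x ≡ inj₂ (G.faceOfWalk (walkH d))))

  link-pullback : ∀ {x y} → G.Link x y → LinkH x y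
  link-pullback (d , inj₁ (p , q)) with representative d
  ... | (x , c , wk) = x , inj₁ (trans p (cong inj₁ (sym c)) , trans q (cong (inj₂ ∘ G.faceOfWalk) (sym wk)))
  link-pullback (d , inj₂ (p , q)) with representative d
  ... | (x , c , wk) = x , inj₂ (trans p (cong inj₁ (sym c)) , trans q (cong (inj₂ ∘ G.faceOfWalk) (sym wk)))

  tree-connH : ∀ x y → Star LinkH x y
  tree-connH x y = gmap (λ z → z) link-pullback (G.tree-conn x y)

  -- Euler's formula for each component i of H.  Compared with G, the
  -- component loses the vertex v and the edge e₁ exactly when it contains
  -- them (δ = 1), and keeps all its facial walks.
  module ComponentCounts (i : Fin G.c) where
    δ : ℕ
    δ = ι (G.compOf d₁ == i)

    VertexG VertexH : Fin (n G) → Bool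
    VertexG t = anyDart (λ d → (G.tail d == t) ∧ (G.compOf d == i))
    VertexH t = anyDart (λ x → (tailH x == t) ∧ (compH x == i))

    WalkH : Fin G.w → Bool
    WalkH j = anyDart (λ x → (walkH x == j) ∧ (compH x == i))

    EdgeH : Fin M' → Bool
    EdgeH e = compH (e , true) == i

    comp-e₁ : G.compOf (e₁ , true) ≡ G.compOf d₁
    comp-e₁ with sameEdge d₁ (e₁ , true) refl
    ... | inj₁ p = cong G.compOf p
    ... | inj₂ p = trans (cong G.compOf p) (G.comp-α d₁)

    comp-lift : ∀ x → compH x ≡ G.compOf (lift x)
    comp-lift x with embed-cases x
    ... | inj₁ (_ , q) = cong G.compOf q
    ... | inj₂ (p , q) =
          trans (cong G.compOf q) (trans (G.comp-α d₁) (trans (sym comp-d₂) (cong G.compOf (sym p))))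

    compE-eq : G.compE i ≡ δ + countFin EdgeH
    compE-eq = trans (countFin-skip e₁ (λ e → G.compOf (e , true) == i))
      (cong₂ _+_ (cong (λ z → ι (z == i)) comp-e₁)
                 (countFin-cong (λ j → cong (_== i) (sym (comp-lift (j , true))))))

    compW-eq : G.compW i ≡ countFin WalkH
    compW-eq = countFin-cong λ j → anyDart-equiv _ _
      (λ d t → let (wj , ci) = ∧-elim t ; (x , c , wk) = representative d in
               x , ∧-intro (subst (λ z → (z == j) ≡ true) (sym wk) wj)
                           (subst (λ z → (z == i) ≡ true) (sym c) ci))
      (λ x t → embed x , t)

    VertexG-v : VertexG v ≡ (G.compOf d₁ == i)
    VertexG-v = bool-ext
      (λ t → let (d , pd) = anyDart-elim (λ d → (G.tail d == v) ∧ (G.compOf d == i)) t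
                 (tv , ci) = ∧-elim pd
             in in-comp d ci (darts-at-v d (==-sound tv)))
      (λ ci → anyDart-intro (λ d → (G.tail d == v) ∧ (G.compOf d == i)) d₁
                            (∧-intro (==-complete t₁) ci))
      where
      in-comp : ∀ d → (G.compOf d == i) ≡ true → d ≡ d₁ ⊎ d ≡ d₂ → (G.compOf d₁ == i) ≡ true
      in-comp d ci (inj₁ refl) = ci
      in-comp d ci (inj₂ refl) = subst (λ z → (z == i) ≡ true) comp-d₂ ci

    VertexH-v : VertexH v ≡ false
    VertexH-v = bool-ext {VertexH v} {false}
      (λ t → let (x , px) = anyDart-elim (λ x → (tailH x == v) ∧ (compH x == i)) t
             in ⊥-elim (embed-off-v x (==-sound (proj₁ (∧-elim px)))))
      (λ ())

    VertexG≡VertexH : ∀ t → t ≢ v → VertexG t ≡ VertexH t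
    VertexG≡VertexH t t≢v = anyDart-equiv _ _
      (λ d pd → let off = λ tv → t≢v (trans (sym (==-sound (proj₁ (∧-elim pd)))) tv) in
                unembed d off ,
                subst (λ z → ((G.tail z == t) ∧ (G.compOf z == i)) ≡ true) (sym (embed-unembed d off)) pd)
      (λ x px → embed x , px)

    compV-eq : G.compV i ≡ δ + countFin VertexH
    compV-eq = begin
        countFin VertexG
      ≡⟨ countFin-skip v VertexG ⟩
        ι (VertexG v) + countFin (VertexG ∘ skip v)
      ≡⟨ cong₂ _+_ (cong ι VertexG-v) (countFin-cong (λ j → VertexG≡VertexH (skip v j) (skip≢ v j))) ⟩
        δ + countFin (VertexH ∘ skip v)
      ≡⟨ cong (δ +_) (cong (_+ countFin (VertexH ∘ skip v)) (cong ι (sym VertexH-v))) ⟩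
        δ + (ι (VertexH v) + countFin (VertexH ∘ skip v))
      ≡⟨ cong (δ +_) (sym (countFin-skip v VertexH)) ⟩
        δ + countFin VertexH
      ∎
      where open ≡-Reasoning

    genus0H : countFin VertexH + countFin WalkH ≡ countFin EdgeH + 2
    genus0H = +-cancelˡ-≡ δ _ _ (begin
        δ + (countFin VertexH + countFin WalkH)    ≡⟨ sym (+-assoc δ _ _) ⟩
        (δ + countFin VertexH) + countFin WalkH    ≡⟨ cong₂ _+_ (sym compV-eq) (sym compW-eq) ⟩
        G.compV i + G.compW i                      ≡⟨ G.genus0 i ⟩
        G.compE i + 2                              ≡⟨ cong (_+ 2) compE-eq ⟩
        (δ + countFin EdgeH) + 2                   ≡⟨ +-assoc δ _ 2 ⟩
        δ + (countFin EdgeH + 2)                   ∎)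
      where open ≡-Reasoning

  H : PlaneGraph
  H = record
    { n = n G ; m = M' ; tail = tailH
    ; noLoop = noLoopH ; noParallel = noParallelH
    ; σ = σH ; σ⁻¹ = σ⁻¹H ; σσ⁻¹ = σσ⁻¹H ; σ⁻¹σ = σ⁻¹σH ; σ-tail = σ-tailH ; σ-cyc = σ-cycH
    ; w = G.w ; walkOf = walkH ; walk-sur = walk-surH ; walk-orb = walk-orbH ; orb-walk = orb-walkH
    ; c = G.c ; compOf = compH ; comp-sur = comp-surH ; comp-σ = comp-σH ; comp-α = comp-αH
    ; comp-con = comp-conH ; genus0 = ComponentCounts.genus0H
    ; f = G.f ; faceOfWalk = G.faceOfWalk ; tree-count = G.tree-count ; tree-conn = tree-connH
    }

  fewer-edges : m H < m G
  fewer-edges = pred< e₁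

  deg-H≤deg-G : ∀ x → deg H x ≤ deg G x
  deg-H≤deg-G x = countD-injective embed embed-injective (λ d → G.tail d == x)

  edge-cases : ∀ e → e ≡ e₁ ⊎ ∃ λ i → skip e₁ i ≡ e
  edge-cases e with e ≟F e₁
  ... | yes p = inj₁ p
  ... | no ¬p = inj₂ (skip-onto e₁ e ¬p)

  meeting-edges : ∀ x y → proj₁ x ≢ proj₁ y → G.tail (lift x) ≡ G.tail (lift y) → tailH x ≡ tailH y
  meeting-edges x y ne tt with embed-cases x | embed-cases y
  ... | inj₁ (_ , q) | inj₁ (_ , q') = trans (cong G.tail q) (trans tt (sym (cong G.tail q')))
  ... | inj₂ (p , _) | _ = ⊥-elim (ne (cong proj₁ (lift-injective
          (trans p (sym (lift-at-v y (trans (sym tt) (trans (cong G.tail p) t₂))))))))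
  ... | inj₁ _ | inj₂ (p , _) = ⊥-elim (ne (cong proj₁ (lift-injective
          (trans (lift-at-v x (trans tt (trans (cong G.tail p) t₂))) (sym p)))))

  -- An edge meeting e₁ in G is incident to u in H: at u anyway, or at v,
  -- where the only other edge is e₂, now rerouted to u.
  meets-e₁ : ∀ b x → G.tail (e₁ , b) ≡ G.tail (lift x) → tailH x ≡ u
  meets-e₁ b x tt with embed-cases x
  ... | inj₂ (_ , q) = trans (cong G.tail q) h₁
  ... | inj₁ (p , q) with sameEdge d₁ (e₁ , b) refl
  ...   | inj₂ r = trans (cong G.tail q) (trans (sym tt) (trans (cong G.tail r) h₁))
  ...   | inj₁ r = ⊥-elim (p (lift-at-v x (trans (sym tt) (trans (cong G.tail r) t₁))))

  on-face : ∀ i β F → faceOf H (i , β) ≡ F → EdgeOnFace H i F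
  on-face i true  F p = inj₁ p
  on-face i false F p = inj₂ p

  on-face-lift : ∀ i F → G.EdgeOnFace (skip e₁ i) F → EdgeOnFace H i F
  on-face-lift i F (inj₁ p) = on-face i true  F (trans (cong G.faceOfWalk (walk-embed (i , true))) p)
  on-face-lift i F (inj₂ p) = on-face i false F (trans (cong G.faceOfWalk (walk-embed (i , false))) p)

  beside-e₁ : ∀ b F → G.faceOf (e₁ , b) ≡ F → EdgeOnFace H i₂ F
  beside-e₁ b F p with sameEdge d₁ (e₁ , b) refl
  ... | inj₁ r = on-face i₂ (not (proj₂ d₂)) F
                   (trans (cong G.faceOfWalk (trans (cong G.walkOf embed-αD₂) (sym walk-d₁)))
                          (trans (cong G.faceOf (sym r)) p))
  ... | inj₂ r = on-face i₂ (proj₂ d₂) F (trans (cong G.faceOf (trans embed-D₂ (sym r))) p)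

  on-face-e₁ : ∀ F → G.EdgeOnFace e₁ F → EdgeOnFace H i₂ F
  on-face-e₁ F (inj₁ p) = beside-e₁ true  F p
  on-face-e₁ F (inj₂ p) = beside-e₁ false F p

  -- Extending a colouring of H: keep all face colours and the colours of
  -- the edges other than e₁, and give e₁ a colour that is neither on an edge
  -- at u in H nor on one of the two faces beside e₁.  At most deg H u + 2
  -- colours are excluded, so with more colours one is free.  (The edge e₂
  -- meets e₁ at v in G; it is at u in H, so its colour is excluded too.)
  module Extension {k : ℕ} (C : EdgeFaceColouring H k) where
    open EdgeFaceColouring C renaming
      (edgeCol to colH; faceCol to faceColH; edge-edge to edge-edgeH; edge-face to edge-faceH; face-face to face-faceH)

    F₁ F₂ : Fin G.f
    F₁ = G.faceOf (e₁ , true)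
    F₂ = G.faceOf (e₁ , false)

    AtU : Fin k → Bool
    AtU c = anyDart (λ x → (tailH x == u) ∧ (colH (proj₁ x) == c))

    Excluded : Fin k → Bool
    Excluded c = AtU c ∨ ((faceColH F₁ == c) ∨ (faceColH F₂ == c))

    excluded-count : countFin Excluded ≤ deg H u + 2
    excluded-count = begin
        countFin Excluded
      ≤⟨ countFin-∨ AtU _ ⟩
        countFin AtU + countFin (λ c → (faceColH F₁ == c) ∨ (faceColH F₂ == c))
      ≤⟨ +-mono-≤ (countD-image (λ x → tailH x == u) (colH ∘ proj₁))
                  (countFin-∨ (faceColH F₁ ==_) (faceColH F₂ ==_)) ⟩
        deg H u + (countFin (faceColH F₁ ==_) + countFin (faceColH F₂ ==_))
      ≡⟨ cong (deg H u +_) (cong₂ _+_ (countFin-single (faceColH F₁)) (countFin-single (faceColH F₂))) ⟩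
        deg H u + 2
      ∎
      where open ≤-Reasoning

    module WithColour (c₁ : Fin k) (free : Excluded c₁ ≡ false) where
      free-parts : AtU c₁ ≡ false × (faceColH F₁ == c₁) ≡ false × (faceColH F₂ == c₁) ≡ false
      free-parts = let (at-u , faces) = ∨-elim-false {AtU c₁} free
                       (on-F₁ , on-F₂) = ∨-elim-false {faceColH F₁ == c₁} faces
                   in at-u , on-F₁ , on-F₂

      not-at-u : ∀ x → tailH x ≡ u → colH (proj₁ x) ≢ c₁
      not-at-u x tu eq = true≢false
        (anyDart-intro (λ x → (tailH x == u) ∧ (colH (proj₁ x) == c₁)) x
                       (∧-intro (==-complete tu) (==-complete eq)))
        (proj₁ free-parts)

      not-beside : ∀ F → G.EdgeOnFace e₁ F → faceColH F ≢ c₁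
      not-beside F (inj₁ refl) eq = true≢false (==-complete eq) (proj₁ (proj₂ free-parts))
      not-beside F (inj₂ refl) eq = true≢false (==-complete eq) (proj₂ (proj₂ free-parts))

      colG : Fin M → Fin k
      colG e with e ≟F e₁
      ... | yes _ = c₁
      ... | no ne = colH (proj₁ (skip-onto e₁ e ne))

      colG-e₁ : colG e₁ ≡ c₁
      colG-e₁ with e₁ ≟F e₁
      ... | yes _ = refl
      ... | no ne = ⊥-elim (ne refl)

      colG-skip : ∀ i → colG (skip e₁ i) ≡ colH i
      colG-skip i with skip e₁ i ≟F e₁
      ... | yes p = ⊥-elim (skip≢ e₁ i p)
      ... | no ne = cong colH (skip-injective e₁ (proj₂ (skip-onto e₁ (skip e₁ i) ne)))

      edge-edgeG : ∀ e e' → G.AdjEdges e e' → colG e ≢ colG e'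
      edge-edgeG e e' (ne , b , b' , tt) with edge-cases e | edge-cases e'
      ... | inj₁ refl | inj₁ refl = ⊥-elim (ne refl)
      ... | inj₁ refl | inj₂ (i' , refl) = λ eq →
            not-at-u (i' , b') (meets-e₁ b (i' , b') tt) (trans (sym (colG-skip i')) (trans (sym eq) colG-e₁))
      ... | inj₂ (i , refl) | inj₁ refl = λ eq →
            not-at-u (i , b) (meets-e₁ b' (i , b) (sym tt)) (trans (sym (colG-skip i)) (trans eq colG-e₁))
      ... | inj₂ (i , refl) | inj₂ (i' , refl) = λ eq →
            edge-edgeH i i' (i≢i' , b , b' , meeting-edges (i , b) (i' , b') i≢i' tt)
                        (trans (sym (colG-skip i)) (trans eq (colG-skip i')))
            where
            i≢i' : i ≢ i'
            i≢i' = ne ∘ cong (skip e₁)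

      edge-faceG : ∀ e F → G.EdgeOnFace e F → colG e ≢ faceColH F
      edge-faceG e F on with edge-cases e
      ... | inj₁ refl = λ eq → not-beside F on (sym (trans (sym colG-e₁) eq))
      ... | inj₂ (i , refl) = λ eq → edge-faceH i F (on-face-lift i F on) (trans (sym (colG-skip i)) eq)

      face-faceG : ∀ F F' → G.AdjFaces F F' → faceColH F ≢ faceColH F'
      face-faceG F F' (ne , e , on , on') with edge-cases e
      ... | inj₁ refl = face-faceH F F' (ne , i₂ , on-face-e₁ F on , on-face-e₁ F' on')
      ... | inj₂ (i , refl) = face-faceH F F' (ne , i , on-face-lift i F on , on-face-lift i F' on')

      colouring : EdgeFaceColouring G k
      colouring = record { edgeCol = colG ; faceCol = faceColH
                         ; edge-edge = edge-edgeG ; edge-face = edge-faceG ; face-face = face-faceG }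

    extend : deg H u + 2 < k → EdgeFaceColouring G k
    extend few = let (c₁ , free) = countFin-gap Excluded (≤-<-trans excluded-count few) in
                 WithColour.colouring c₁ free

lemma8 : (G : PlaneGraph) → MinimalCounterexample G →
    (v u w : Fin (n G)) → deg G v ≡ 2 → Adj G v u → Adj G v w → u ≢ w →
    deg G u ≤ 6 → Adj G u w
lemma8 G mc v u w deg-v (d₁ , t₁ , h₁) (d₂ , t₂ , h₂) u≢w deg-u with adjacent? G u w
... | yes u∼w = u∼w
... | no  u≁w = ⊥-elim (notColourable (Extension.extend colouringH few-excluded))
  where
  open MinimalCounterexample mc
  open Suppression G v u w d₁ d₂ t₁ h₁ t₂ h₂ deg-v u≢w u≁w

  max-degree-H : MaxDegAtMost H 8
  max-degree-H x = ≤-trans (deg-H≤deg-G x) (proj₁ maxDeg8 x)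

  colouringH : EdgeFaceColouring H 9
  colouringH = minimal H fewer-edges max-degree-H

  few-excluded : deg H u + 2 < 9
  few-excluded = s≤s (+-monoˡ-≤ 2 (≤-trans (deg-H≤deg-G u) deg-u))
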